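{- Let $n,k,r$ be positive integers with $k\le \frac{n}{560\, r^{3/4}}$. Then every locally $k$-bounded coloring $c$ of $E(K_n)$ contains a complete subgraph $H$ on at least $2r^{1/4}$ vertices which is properly colored by $c$, and every globally $k$-bounded coloring $c$ of $E(K_n)$ contains a complete subgraph $H$ on at least $2r^{1/4}$ vertices which is rainbow in $c$; moreover in both cases $H$ can be chosen so that for every two distinct vertices $v_1,v_3\in V(H)$, the set $\{v_2\in V(K_n): c(v_1v_2)=c(v_2v_3)\}$ has size at most $5kr^{1/4}$.
   Context: An edge-coloring $c$ of $E(K_n)$ is locally $k$-bounded if for every vertex $v$, no color appears on more than $k$ of the edges incident to $v$; it is globally $k$-bounded if no color appears on more than $k$ edges of $K_n$. A subgraph is properly colored if no two of its edges sharing a vertex have the same color, and rainbow if no two of its edges have the same color. -}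

module Defs where

open import Data.Nat using (ℕ; _≤_; _*_; _^_)
open import Data.Fin using (Fin; _<_; _<?_)
open import Data.Fin.Subset using (Subset; _∈_; ∣_∣)
open import Data.List using (List; length; filter; allFin; concatMap; map)
open import Data.Product using (_×_; _,_; proj₁; proj₂; ∃)
open import Data.Sum using (_⊎_)
open import Relation.Nullary using (¬_)
open import Relation.Nullary.Decidable using (_×-dec_; ¬?)
open import Relation.Binary.PropositionalEquality using (_≡_; _≢_)
import Data.Fin as F
import Data.Nat as N

-- An edge-colouring of K_n on vertex set Fin n, colours in ℕ.
-- c u v is the colour of edge uv (u ≢ v); diagonal values are never used.
Coloring : ℕ → Set
Coloring n = Fin n → Fin n → ℕ

Symmetric : ∀ {n} → Coloring n → Set
Symmetric {n} c = ∀ (u v : Fin n) → c u v ≡ c v u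

edges : ∀ n → List (Fin n × Fin n)
edges n = filter (λ p → proj₁ p <? proj₂ p)
                 (concatMap (λ u → map (u ,_) (allFin n)) (allFin n))

degColor : ∀ {n} → Coloring n → Fin n → ℕ → ℕ
degColor {n} c v a =
  length (filter (λ u → ¬? (u F.≟ v) ×-dec (c v u N.≟ a)) (allFin n))

numColor : ∀ {n} → Coloring n → ℕ → ℕ
numColor {n} c a =
  length (filter (λ p → c (proj₁ p) (proj₂ p) N.≟ a) (edges n))

LocallyBounded : ∀ {n} → ℕ → Coloring n → Set
LocallyBounded k c = ∀ v a → degColor c v a ≤ k

GloballyBounded : ∀ {n} → ℕ → Coloring n → Set
GloballyBounded k c = ∀ a → numColor c a ≤ k

ProperlyColored : ∀ {n} → Coloring n → Subset n → Set
ProperlyColored c H = ∀ x y z → x ∈ H → y ∈ H → z ∈ H →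
  x ≢ y → x ≢ z → y ≢ z → c x y ≢ c x z

Rainbow : ∀ {n} → Coloring n → Subset n → Set
Rainbow c H = ∀ x y z w → x ∈ H → y ∈ H → z ∈ H → w ∈ H →
  x ≢ y → z ≢ w → ¬ ((x ≡ z × y ≡ w) ⊎ (x ≡ w × y ≡ z)) →
  c x y ≢ c z w

-- |{ v2 ∈ V(K_n) : c(v1 v2) = c(v2 v3) }| (v2 ranging over vertices
-- distinct from v1, v3 so that both v1v2 and v2v3 are edges)
codeg : ∀ {n} → Coloring n → Fin n → Fin n → ℕ
codeg {n} c v1 v3 =
  length (filter (λ v2 → ¬? (v2 F.≟ v1) ×-dec (¬? (v2 F.≟ v3) ×-dec (c v1 v2 N.≟ c v2 v3)))
                 (allFin n))

-- codeg c v1 v3 ≤ 5 k r^{1/4}  ⇔  (codeg)^4 ≤ 625 k^4 r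
SmallCodeg : ∀ {n} → ℕ → ℕ → Coloring n → Subset n → Set
SmallCodeg k r c H = ∀ v1 v3 → v1 ∈ H → v3 ∈ H → v1 ≢ v3 →
  codeg c v1 v3 ^ 4 ≤ 625 * k ^ 4 * r

-- |H| ≥ 2 r^{1/4}  ⇔  16 r ≤ |H|^4
LargeEnough : ∀ {n} → ℕ → Subset n → Set
LargeEnough r H = 16 * r ≤ ∣ H ∣ ^ 4

module Submission where

-- Let s = ⌊r^{1/4}⌋ ≥ 1, so that n ≥ 560ks³, and set D = 5ks.
-- For a locally k-bounded colouring we grow a vertex set h, keeping it a
-- rainbow clique in which all codegrees are at most D.  A vertex u can be
-- added unless it is obstructed: u ∈ h, or codeg(x,u) > D for some x ∈ h, or
-- an edge xu repeats a colour of h, or two edges xu, uy have the same colour.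
-- Double counting bounds the number of obstructions by
--   |h| + Σ_{x∈h} #{u : codeg(x,u) > D} + |h|³k + |h|²D,
-- where Σ_u codeg(x,u) ≤ nk (Markov) controls the second term; for |h| ≤ 3s
-- this is below n, so some vertex is unobstructed and h grows to 2s+2 ≥ 2r^{1/4}
-- vertices.  A rainbow clique is properly coloured, and a globally k-bounded
-- symmetric colouring is locally k-bounded, which gives both halves.

open import Defs
open import Data.Bool using (Bool; true; false; _∨_)
open import Data.Fin using (Fin; zero; suc) renaming (_<_ to _<ᶠ_)
open import Data.Fin.Subset using (Subset; _∈_; ∣_∣)
open import Data.List using (List; []; _∷_; _++_; length; filter; tabulate; concatMap; map; allFin)
open import Data.List.Properties using (filter-++; length-++; map-tabulate)
open import Data.Nat using (ℕ; zero; suc; _+_; _*_; _^_; _≤_; _<_; z≤n; s≤s; _≤?_; _≟_; >-nonZero)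
open import Data.Nat.Properties
open import Algebra.Properties.Semiring.Sum +-*-semiring
  using (sum; ∑-distrib-+; ∑-comm; *-distribˡ-sum; *-distribʳ-sum; sum-cong-≗)
open import Data.Nat.Tactic.RingSolver using (solve-∀)
open import Data.Product using (_×_; _,_; ∃; Σ; proj₁; proj₂)
open import Data.Sum using (_⊎_; inj₁; inj₂)
open import Function using (_∘_; id)
open import Relation.Binary using (tri<; tri≈; tri>)
open import Relation.Binary.PropositionalEquality
open import Relation.Nullary using (¬_; Dec; yes; no; does; contradiction)
open import Relation.Nullary.Decidable using (_×-dec_; ¬?)
open import Relation.Unary using (Decidable)
import Data.Fin.Properties as Fin
import Data.Vec as Vec
open import Data.Vec.Properties using (lookup∘tabulate; []=⇒lookup)

⟦_⟧ : Bool → ℕ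
⟦ true ⟧  = 1
⟦ false ⟧ = 0

𝟙 : {P : Set} → Dec P → ℕ
𝟙 d = ⟦ does d ⟧

𝟙-mono : {P Q : Set} (p : Dec P) (q : Dec Q) → (P → Q) → 𝟙 p ≤ 𝟙 q
𝟙-mono (yes _) (yes _) _   = ≤-refl
𝟙-mono (yes p) (no ¬q) p→q = contradiction (p→q p) ¬q
𝟙-mono (no _)  _       _   = z≤n

𝟙-cong : {P Q : Set} (p : Dec P) (q : Dec Q) → (P → Q) → (Q → P) → 𝟙 p ≡ 𝟙 q
𝟙-cong p q p→q q→p = ≤-antisym (𝟙-mono p q p→q) (𝟙-mono q p q→p)

𝟙-no : {P : Set} (d : Dec P) → ¬ P → 𝟙 d ≡ 0
𝟙-no (yes p) ¬p = contradiction p ¬p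
𝟙-no (no _)  _  = refl

𝟙≡0⇒¬ : {P : Set} (d : Dec P) → 𝟙 d ≡ 0 → ¬ P
𝟙≡0⇒¬ (no ¬p) _ = ¬p

𝟙-⊎ : {P Q R : Set} (p : Dec P) (q : Dec Q) (r : Dec R) → (P → Q ⊎ R) → 𝟙 p ≤ 𝟙 q + 𝟙 r
𝟙-⊎ (no _)  q r _ = z≤n
𝟙-⊎ (yes p) q r p→q⊎r with p→q⊎r p
... | inj₁ x = ≤-trans (𝟙-mono (yes p) q λ _ → x) (m≤m+n (𝟙 q) (𝟙 r))
... | inj₂ y = ≤-trans (𝟙-mono (yes p) r λ _ → y) (m≤n+m (𝟙 r) (𝟙 q))

𝟙*-≤ : {P : Set} (d : Dec P) {m C : ℕ} → (P → m ≤ C) → 𝟙 d * m ≤ C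
𝟙*-≤ (yes p) {m} m≤C = ≤-trans (≤-reflexive (+-identityʳ m)) (m≤C p)
𝟙*-≤ (no _)      _   = z≤n

𝟙*≡0 : {P : Set} (d : Dec P) (m : ℕ) → 𝟙 d * m ≡ 0 → P → m ≡ 0
𝟙*≡0 (yes _) m e _ = trans (sym (+-identityʳ m)) e
𝟙*≡0 (no ¬p) m _ p = contradiction p ¬p

sum-mono : ∀ {n} {f g : Fin n → ℕ} → (∀ i → f i ≤ g i) → sum f ≤ sum g
sum-mono {zero}  _   = z≤n
sum-mono {suc n} f≤g = +-mono-≤ (f≤g zero) (sum-mono (f≤g ∘ suc))

sum-const : ∀ n (c : ℕ) → sum {n} (λ _ → c) ≡ n * c
sum-const zero    c = refl
sum-const (suc n) c = cong (c +_) (sum-const n c)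

sum-bounded : ∀ {n} {f : Fin n → ℕ} (c : ℕ) → (∀ i → f i ≤ c) → sum f ≤ n * c
sum-bounded {n} c f≤c = ≤-trans (sum-mono f≤c) (≤-reflexive (sum-const n c))

term≤sum : ∀ {n} (f : Fin n → ℕ) i → f i ≤ sum f
term≤sum f zero    = m≤m+n _ _
term≤sum f (suc i) = ≤-trans (term≤sum (f ∘ suc) i) (m≤n+m _ _)

sum≡0 : ∀ {n} (f : Fin n → ℕ) → sum f ≡ 0 → ∀ i → f i ≡ 0
sum≡0 f e i = n≤0⇒n≡0 (≤-trans (term≤sum f i) (≤-reflexive e))

zero-term : ∀ {n} (f : Fin n → ℕ) → sum f < n → ∃ λ i → f i ≡ 0
zero-term {suc n} f sum<n with f zero in eq
... | zero  = zero , eq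
... | suc a with zero-term (f ∘ suc) (≤-trans (s≤s (m≤n+m _ a)) (≤-pred sum<n))
...   | i , fi≡0 = suc i , fi≡0

sum-𝟙-≟ : ∀ {n} (v : Fin n) → sum (λ x → 𝟙 (x Fin.≟ v)) ≡ 1
sum-𝟙-≟ {suc n} zero = cong suc (begin
    sum {n} (λ i → 𝟙 (suc i Fin.≟ zero)) ≡⟨ sum-cong-≗ {n} (λ i → 𝟙-no (suc i Fin.≟ zero) λ ()) ⟩
    sum {n} (λ _ → 0)                ≡⟨ sum-const n 0 ⟩
    n * 0                            ≡⟨ *-zeroʳ n ⟩
    0                                ∎)
  where open ≡-Reasoning
sum-𝟙-≟ {suc n} (suc v) = trans (sum-cong-≗ λ x → 𝟙-cong (suc x Fin.≟ suc v) (x Fin.≟ v) Fin.suc-injective (cong suc)) (sum-𝟙-≟ v)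

markov : ∀ {n} (f : Fin n → ℕ) D → sum (λ i → 𝟙 (suc D ≤? f i)) * suc D ≤ sum f
markov f D = ≤-trans (≤-reflexive (*-distribʳ-sum (suc D) (λ i → 𝟙 (suc D ≤? f i)))) (sum-mono large)
  where
    large : ∀ i → 𝟙 (suc D ≤? f i) * suc D ≤ f i
    large i = 𝟙*-≤ (suc D ≤? f i) λ D<fi → D<fi

row+column≤total : ∀ {n} (f : Fin n → Fin n → ℕ) v → f v v ≡ 0 →
  sum (f v) + sum (λ x → f x v) ≤ sum (λ x → sum (f x))
row+column≤total f v fvv≡0 = begin
    sum (f v) + sum (λ x → f x v)
  ≡⟨ cong (_+ sum (λ x → f x v)) (sym row-as-sum) ⟩
    sum (λ x → 𝟙 (x Fin.≟ v) * sum (f v)) + sum (λ x → f x v)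
  ≡⟨ sym (∑-distrib-+ (λ x → 𝟙 (x Fin.≟ v) * sum (f v)) (λ x → f x v)) ⟩
    sum (λ x → 𝟙 (x Fin.≟ v) * sum (f v) + f x v)
  ≤⟨ sum-mono pointwise ⟩
    sum (λ x → sum (f x)) ∎
  where
    open ≤-Reasoning
    row-as-sum : sum (λ x → 𝟙 (x Fin.≟ v) * sum (f v)) ≡ sum (f v)
    row-as-sum = trans (sym (*-distribʳ-sum (sum (f v)) (λ x → 𝟙 (x Fin.≟ v))))
                       (trans (cong (_* sum (f v)) (sum-𝟙-≟ v)) (*-identityˡ _))
    pointwise : ∀ x → 𝟙 (x Fin.≟ v) * sum (f v) + f x v ≤ sum (f x)
    pointwise x with x Fin.≟ v
    ... | yes refl = ≤-reflexive (trans (cong₂ _+_ (+-identityʳ (sum (f x))) fvv≡0) (+-identityʳ _))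
    ... | no _     = term≤sum (f x) v

count-tabulate : ∀ {A : Set} {P : A → Set} (P? : Decidable P) {n} (f : Fin n → A) →
  length (filter P? (tabulate f)) ≡ sum (λ i → 𝟙 (P? (f i)))
count-tabulate P? {zero}  f = refl
count-tabulate P? {suc n} f with does (P? (f zero))
... | true  = cong suc (count-tabulate P? (f ∘ suc))
... | false = count-tabulate P? (f ∘ suc)

count-concatMap : ∀ {A B : Set} {P : B → Set} (P? : Decidable P) (g : A → List B) {n} (f : Fin n → A) →
  length (filter P? (concatMap g (tabulate f))) ≡ sum (λ i → length (filter P? (g (f i))))
count-concatMap P? g {zero}  f = refl
count-concatMap P? g {suc n} f = begin
    length (filter P? (g (f zero) ++ concatMap g (tabulate (f ∘ suc))))
  ≡⟨ cong length (filter-++ P? (g (f zero)) _) ⟩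
    length (filter P? (g (f zero)) ++ filter P? (concatMap g (tabulate (f ∘ suc))))
  ≡⟨ length-++ (filter P? (g (f zero))) ⟩
    length (filter P? (g (f zero))) + length (filter P? (concatMap g (tabulate (f ∘ suc))))
  ≡⟨ cong (length (filter P? (g (f zero))) +_) (count-concatMap P? g (f ∘ suc)) ⟩
    sum (λ i → length (filter P? (g (f i)))) ∎
  where open ≡-Reasoning

count-filter-filter : ∀ {A : Set} {P Q : A → Set} (P? : Decidable P) (Q? : Decidable Q) (xs : List A) →
  length (filter P? (filter Q? xs)) ≡ length (filter (λ x → Q? x ×-dec P? x) xs)
count-filter-filter P? Q? [] = refl
count-filter-filter P? Q? (x ∷ xs) with Q? x
... | no _ = count-filter-filter P? Q? xs
... | yes _ with P? x
...   | yes _ = cong suc (count-filter-filter P? Q? xs)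
...   | no _  = count-filter-filter P? Q? xs

size : ∀ {n} → (Fin n → Bool) → ℕ
size h = sum (⟦_⟧ ∘ h)

sumIn : ∀ {n} → (Fin n → Bool) → (Fin n → ℕ) → ℕ
sumIn h f = sum (λ x → ⟦ h x ⟧ * f x)

sumIn-bounded : ∀ {n} (h : Fin n → Bool) {f : Fin n → ℕ} (C : ℕ) →
  (∀ x → h x ≡ true → f x ≤ C) → sumIn h f ≤ size h * C
sumIn-bounded h {f} C f≤C = ≤-trans (sum-mono pointwise) (≤-reflexive (sym (*-distribʳ-sum C (⟦_⟧ ∘ h))))
  where
    pointwise : ∀ x → ⟦ h x ⟧ * f x ≤ ⟦ h x ⟧ * C
    pointwise x with h x in hx
    ... | true  = *-monoʳ-≤ 1 (f≤C x hx)
    ... | false = z≤n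

sumIn≡0 : ∀ {n} (h : Fin n → Bool) (f : Fin n → ℕ) → sumIn h f ≡ 0 → ∀ x → h x ≡ true → f x ≡ 0
sumIn≡0 h f e x hx with sum≡0 (λ y → ⟦ h y ⟧ * f y) e x
... | hxfx≡0 rewrite hx = trans (sym (+-identityʳ (f x))) hxfx≡0

sum-sumIn : ∀ {m n} (h : Fin m → Bool) (g : Fin m → Fin n → ℕ) →
  sum (λ u → sumIn h (λ x → g x u)) ≡ sumIn h (λ x → sum (g x))
sum-sumIn h g = trans (∑-comm (λ u x → ⟦ h x ⟧ * g x u))
                      (sum-cong-≗ λ x → sym (*-distribˡ-sum ⟦ h x ⟧ (g x)))

sumIn-swap-bounded : ∀ {m n} (h : Fin m → Bool) (g : Fin m → Fin n → ℕ) (C : ℕ) →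
  (∀ x → h x ≡ true → sum (g x) ≤ C) → sum (λ u → sumIn h (λ x → g x u)) ≤ size h * C
sumIn-swap-bounded h g C bound = ≤-trans (≤-reflexive (sum-sumIn h g)) (sumIn-bounded h C bound)

module _ {n : ℕ} (c : Coloring n) where

  colourEdge : ℕ → Fin n → Fin n → ℕ
  colourEdge a x y = 𝟙 ((x Fin.<? y) ×-dec (c x y ≟ a))

  numColor≡ : ∀ a → numColor c a ≡ sum (λ x → sum (colourEdge a x))
  numColor≡ a = begin
      length (filter P? (filter Q? pairs))
    ≡⟨ count-filter-filter P? Q? pairs ⟩
      length (filter R? pairs)
    ≡⟨ count-concatMap R? row id ⟩
      sum (λ x → length (filter R? (row x)))
    ≡⟨ sum-cong-≗ {n} (λ x → trans (cong (length ∘ filter R?) (map-tabulate id (x ,_)))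
                                  (count-tabulate R? (x ,_))) ⟩
      sum (λ x → sum (colourEdge a x)) ∎
    where
      open ≡-Reasoning
      row : Fin n → List (Fin n × Fin n)
      row u = map (u ,_) (allFin n)
      pairs : List (Fin n × Fin n)
      pairs = concatMap row (allFin n)
      P? Q? R? : Decidable {A = Fin n × Fin n} _
      P? p = c (proj₁ p) (proj₂ p) ≟ a
      Q? p = proj₁ p Fin.<? proj₂ p
      R? p = Q? p ×-dec P? p

  degColor≡ : ∀ v a → degColor c v a ≡ sum (λ u → 𝟙 (¬? (u Fin.≟ v) ×-dec (c v u ≟ a)))
  degColor≡ v a = count-tabulate (λ u → ¬? (u Fin.≟ v) ×-dec (c v u ≟ a)) id

  -- For a symmetric colouring every colour-a edge at v is counted once by
  -- numColor, so a global bound k is also a local bound.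
  globally⇒locally : ∀ k → Symmetric c → GloballyBounded k c → LocallyBounded k c
  globally⇒locally k c-sym bounded v a = begin
      degColor c v a
    ≡⟨ degColor≡ v a ⟩
      sum (λ u → 𝟙 (¬? (u Fin.≟ v) ×-dec (c v u ≟ a)))
    ≤⟨ sum-mono (λ u → 𝟙-⊎ (¬? (u Fin.≟ v) ×-dec (c v u ≟ a)) ((v Fin.<? u) ×-dec (c v u ≟ a))
                                ((u Fin.<? v) ×-dec (c u v ≟ a)) (oriented u)) ⟩
      sum (λ u → colourEdge a v u + colourEdge a u v)
    ≡⟨ ∑-distrib-+ (colourEdge a v) (λ u → colourEdge a u v) ⟩
      sum (colourEdge a v) + sum (λ u → colourEdge a u v)
    ≤⟨ row+column≤total (colourEdge a) v (𝟙-no ((v Fin.<? v) ×-dec (c v v ≟ a)) λ (v<v , _) → Fin.<-irrefl refl v<v) ⟩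
      sum (λ x → sum (colourEdge a x))
    ≡⟨ sym (numColor≡ a) ⟩
      numColor c a
    ≤⟨ bounded a ⟩
      k ∎
    where
      open ≤-Reasoning
      oriented : ∀ u → u ≢ v × c v u ≡ a → (v <ᶠ u × c v u ≡ a) ⊎ (u <ᶠ v × c u v ≡ a)
      oriented u (u≢v , cvu≡a) with Fin.<-cmp v u
      ... | tri< v<u _ _ = inj₁ (v<u , cvu≡a)
      ... | tri≈ _ v≡u _ = contradiction (sym v≡u) u≢v
      ... | tri> _ _ u<v = inj₂ (u<v , trans (c-sym u v) cvu≡a)

-- Codegrees: codeg c x y counts the monochromatic paths x v y.
module _ {n : ℕ} (c : Coloring n) where

  cherry? : (x y v : Fin n) → Dec (v ≢ x × v ≢ y × c x v ≡ c v y)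
  cherry? x y v = ¬? (v Fin.≟ x) ×-dec (¬? (v Fin.≟ y) ×-dec (c x v ≟ c v y))

  codeg≡ : ∀ x y → codeg c x y ≡ sum (𝟙 ∘ cherry? x y)
  codeg≡ x y = count-tabulate (cherry? x y) id

  codeg-sym : Symmetric c → ∀ x y → codeg c x y ≡ codeg c y x
  codeg-sym c-sym x y = begin
      codeg c x y               ≡⟨ codeg≡ x y ⟩
      sum (𝟙 ∘ cherry? x y)     ≡⟨ sum-cong-≗ {n} (λ v → 𝟙-cong (cherry? x y v) (cherry? y x v) (reverse x y v) (reverse y x v)) ⟩
      sum (𝟙 ∘ cherry? y x)     ≡⟨ sym (codeg≡ y x) ⟩
      codeg c y x               ∎
    where
      open ≡-Reasoning
      reverse : ∀ x y v → v ≢ x × v ≢ y × c x v ≡ c v y → v ≢ y × v ≢ x × c y v ≡ c v x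
      reverse x y v (v≢x , v≢y , e) = v≢y , v≢x , trans (c-sym y v) (trans (sym e) (c-sym x v))

  -- Swapping the order of summation, Σ_u codeg(x,u) counts, for each middle
  -- vertex v, the edges vu of colour c(x,v): at most k of them.
  codeg-row-sum : ∀ k → LocallyBounded k c → ∀ x → sum (codeg c x) ≤ n * k
  codeg-row-sum k bounded x = begin
      sum (codeg c x)
    ≡⟨ sum-cong-≗ {n} (codeg≡ x) ⟩
      sum (λ u → sum (𝟙 ∘ cherry? x u))
    ≡⟨ ∑-comm (λ u v → 𝟙 (cherry? x u v)) ⟩
      sum (λ v → sum (λ u → 𝟙 (cherry? x u v)))
    ≤⟨ sum-bounded k (λ v → ≤-trans (sum-mono (λ u → 𝟙-mono (cherry? x u v) (edge? v u) out-edge))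
                                    (≤-trans (≤-reflexive (sym (degColor≡ c v (c x v)))) (bounded v (c x v)))) ⟩
      n * k ∎
    where
      open ≤-Reasoning
      edge? : ∀ v u → Dec (u ≢ v × c v u ≡ c x v)
      edge? v u = ¬? (u Fin.≟ v) ×-dec (c v u ≟ c x v)
      out-edge : ∀ {u v} → v ≢ x × v ≢ u × c x v ≡ c v u → u ≢ v × c v u ≡ c x v
      out-edge (_ , v≢u , e) = (λ u≡v → v≢u (sym u≡v)) , sym e

  few-heavy : ∀ k → LocallyBounded k c → ∀ x D → sum (λ u → 𝟙 (suc D ≤? codeg c x u)) * suc D ≤ n * k
  few-heavy k bounded x D = ≤-trans (markov (codeg c x) D) (codeg-row-sum k bounded x)

module GreedyStep {n : ℕ} (c : Coloring n) (c-sym : Symmetric c) (k : ℕ)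
                  (bounded : LocallyBounded k c) (D : ℕ) where

  IsRainbow : (Fin n → Bool) → Set
  IsRainbow h = ∀ x y z w → h x ≡ true → h y ≡ true → h z ≡ true → h w ≡ true →
    x ≢ y → z ≢ w → ¬ ((x ≡ z × y ≡ w) ⊎ (x ≡ w × y ≡ z)) → c x y ≢ c z w

  LowCodeg : (Fin n → Bool) → Set
  LowCodeg h = ∀ x y → h x ≡ true → h y ≡ true → x ≢ y → codeg c x y ≤ D

  record Addable (h : Fin n → Bool) (u : Fin n) : Set where
    field
      fresh      : h u ≡ false
      light      : ∀ x → h x ≡ true → codeg c x u ≤ D
      new-colour : ∀ x y z → h x ≡ true → h y ≡ true → h z ≡ true → y ≢ z → c x u ≢ c y z
      no-cherry  : ∀ x y → h x ≡ true → h y ≡ true → x ≢ y → c x u ≢ c u y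

  outside≢ : ∀ {h : Fin n → Bool} {u x} → h u ≡ false → h x ≡ true → u ≢ x
  outside≢ hu≡false hx≡true refl with trans (sym hu≡false) hx≡true
  ... | ()

  insert : (Fin n → Bool) → Fin n → Fin n → Bool
  insert h u x = h x ∨ does (x Fin.≟ u)

  insert-member : ∀ h u x → insert h u x ≡ true → h x ≡ true ⊎ x ≡ u
  insert-member h u x member with h x | x Fin.≟ u
  ... | true  | _      = inj₁ refl
  ... | false | yes x≡u = inj₂ x≡u

  module Insertion {h : Fin n → Bool} {u : Fin n} (addable : Addable h u) where
    open Addable addable

    insert-size : size (insert h u) ≡ suc (size h)
    insert-size = begin
        sum (λ x → ⟦ insert h u x ⟧)
      ≡⟨ sum-cong-≗ {n} count ⟩
        sum (λ x → ⟦ h x ⟧ + 𝟙 (x Fin.≟ u))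
      ≡⟨ ∑-distrib-+ (⟦_⟧ ∘ h) (λ x → 𝟙 (x Fin.≟ u)) ⟩
        size h + sum (λ x → 𝟙 (x Fin.≟ u))
      ≡⟨ cong (size h +_) (sum-𝟙-≟ u) ⟩
        size h + 1
      ≡⟨ +-comm (size h) 1 ⟩
        suc (size h) ∎
      where
        open ≡-Reasoning
        count : ∀ x → ⟦ insert h u x ⟧ ≡ ⟦ h x ⟧ + 𝟙 (x Fin.≟ u)
        count x with x Fin.≟ u
        ... | yes refl rewrite fresh = refl
        ... | no _ with h x
        ...   | true  = refl
        ...   | false = refl

    data EdgeKind (x y : Fin n) : Set where
      old : h x ≡ true → h y ≡ true → EdgeKind x y
      new : (p : Fin n) → h p ≡ true → (x ≡ p × y ≡ u) ⊎ (x ≡ u × y ≡ p) → c x y ≡ c p u → EdgeKind x y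

    classify : ∀ x y → insert h u x ≡ true → insert h u y ≡ true → x ≢ y → EdgeKind x y
    classify x y x∈ y∈ x≢y with insert-member h u x x∈ | insert-member h u y y∈
    ... | inj₁ hx   | inj₁ hy   = old hx hy
    ... | inj₁ hx   | inj₂ refl = new x hx (inj₁ (refl , refl)) refl
    ... | inj₂ refl | inj₁ hy   = new y hy (inj₂ (refl , refl)) (c-sym u y)
    ... | inj₂ refl | inj₂ refl = contradiction refl x≢y

    same-edge : ∀ {x y z w p} → (x ≡ p × y ≡ u) ⊎ (x ≡ u × y ≡ p) → (z ≡ p × w ≡ u) ⊎ (z ≡ u × w ≡ p) →
      (x ≡ z × y ≡ w) ⊎ (x ≡ w × y ≡ z)
    same-edge (inj₁ (refl , refl)) (inj₁ (refl , refl)) = inj₁ (refl , refl)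
    same-edge (inj₁ (refl , refl)) (inj₂ (refl , refl)) = inj₂ (refl , refl)
    same-edge (inj₂ (refl , refl)) (inj₁ (refl , refl)) = inj₂ (refl , refl)
    same-edge (inj₂ (refl , refl)) (inj₂ (refl , refl)) = inj₁ (refl , refl)

    -- Two distinct edges of equal colour would contradict rainbowness of h,
    -- new-colour, or no-cherry, according to how many of them are new.
    insert-rainbow : IsRainbow h → IsRainbow (insert h u)
    insert-rainbow rainbow x y z w x∈ y∈ z∈ w∈ x≢y z≢w distinct cxy≡czw
      with classify x y x∈ y∈ x≢y | classify z w z∈ w∈ z≢w
    ... | old hx hy | old hz hw = rainbow x y z w hx hy hz hw x≢y z≢w distinct cxy≡czw
    ... | old hx hy | new q hq _ czw≡cqu =
      new-colour q x y hq hx hy x≢y (sym (trans cxy≡czw czw≡cqu))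
    ... | new p hp _ cxy≡cpu | old hz hw =
      new-colour p z w hp hz hw z≢w (trans (sym cxy≡cpu) cxy≡czw)
    ... | new p hp xy-ends cxy≡cpu | new q hq zw-ends czw≡cqu =
      no-cherry p q hp hq p≢q (trans (sym cxy≡cpu) (trans cxy≡czw (trans czw≡cqu (c-sym q u))))
      where
        p≢q : p ≢ q
        p≢q refl = distinct (same-edge xy-ends zw-ends)

    insert-lowCodeg : LowCodeg h → LowCodeg (insert h u)
    insert-lowCodeg low x y x∈ y∈ x≢y with insert-member h u x x∈ | insert-member h u y y∈
    ... | inj₁ hx   | inj₁ hy   = low x y hx hy x≢y
    ... | inj₁ hx   | inj₂ refl = light x hx
    ... | inj₂ refl | inj₁ hy   = ≤-trans (≤-reflexive (codeg-sym c c-sym u y)) (light y hy)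
    ... | inj₂ refl | inj₂ refl = contradiction refl x≢y

  -- The obstructions to adding u to h, counted with multiplicity: u ∈ h;
  -- x ∈ h with codeg(x,u) > D; x,y,z ∈ h, y ≠ z, with c(xu) = c(yz);
  -- x,y ∈ h, x ≠ y, with c(xu) = c(uy).
  repeatAt : (x y z u : Fin n) → ℕ
  repeatAt x y z u = 𝟙 (¬? (y Fin.≟ z)) * 𝟙 (¬? (u Fin.≟ x) ×-dec (c x u ≟ c y z))

  cherryAt : (x y u : Fin n) → ℕ
  cherryAt x y u = 𝟙 (¬? (x Fin.≟ y)) * 𝟙 (cherry? c x y u)

  heavy repeats cherries obstructions : (Fin n → Bool) → Fin n → ℕ
  heavy h u = sumIn h (λ x → 𝟙 (suc D ≤? codeg c x u))
  repeats h u = sumIn h λ x → sumIn h λ y → sumIn h λ z → repeatAt x y z u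
  cherries h u = sumIn h λ x → sumIn h λ y → cherryAt x y u
  obstructions h u = ⟦ h u ⟧ + heavy h u + repeats h u + cherries h u

  unobstructed⇒addable : ∀ h u → obstructions h u ≡ 0 → Addable h u
  unobstructed⇒addable h u none = record
    { fresh      = fresh
    ; light      = λ x hx → ≮⇒≥ (𝟙≡0⇒¬ (suc D ≤? codeg c x u) (sumIn≡0 h _ heavy≡0 x hx))
    ; new-colour = λ x y z hx hy hz y≢z cxu≡cyz →
        𝟙≡0⇒¬ (¬? (u Fin.≟ x) ×-dec (c x u ≟ c y z))
          (𝟙*≡0 (¬? (y Fin.≟ z)) _ (sumIn≡0 h _ (sumIn≡0 h _ (sumIn≡0 h _ repeats≡0 x hx) y hy) z hz) y≢z)
          (outside≢ fresh hx , cxu≡cyz)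
    ; no-cherry  = λ x y hx hy x≢y cxu≡cuy →
        𝟙≡0⇒¬ (cherry? c x y u)
          (𝟙*≡0 (¬? (x Fin.≟ y)) _ (sumIn≡0 h _ (sumIn≡0 h _ cherries≡0 x hx) y hy) x≢y)
          (outside≢ fresh hx , outside≢ fresh hy , cxu≡cuy)
    }
    where
      first-three≡0 : ⟦ h u ⟧ + heavy h u + repeats h u ≡ 0
      first-three≡0 = m+n≡0⇒m≡0 _ none
      first-two≡0 : ⟦ h u ⟧ + heavy h u ≡ 0
      first-two≡0 = m+n≡0⇒m≡0 _ first-three≡0
      cherries≡0 : cherries h u ≡ 0
      cherries≡0 = m+n≡0⇒n≡0 (⟦ h u ⟧ + heavy h u + repeats h u) none
      repeats≡0 : repeats h u ≡ 0
      repeats≡0 = m+n≡0⇒n≡0 (⟦ h u ⟧ + heavy h u) first-three≡0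
      heavy≡0 : heavy h u ≡ 0
      heavy≡0 = m+n≡0⇒n≡0 ⟦ h u ⟧ first-two≡0

      fresh : h u ≡ false
      fresh with h u | m+n≡0⇒m≡0 ⟦ h u ⟧ first-two≡0
      ... | false | _ = refl

  heavyTotal : (Fin n → Bool) → ℕ
  heavyTotal h = sumIn h (λ x → sum (λ u → 𝟙 (suc D ≤? codeg c x u)))

  -- Double counting: summing the obstructions over all u, each triple
  -- (x,y,z) is charged at most k times (edges at x of colour c(yz)) and each
  -- pair (x,y) at most codeg(x,y) ≤ D times.
  total-obstructions : ∀ h → LowCodeg h →
    sum (obstructions h) ≤ size h + heavyTotal h + size h * (size h * (size h * k)) + size h * (size h * D)
  total-obstructions h low = begin
      sum (obstructions h)
    ≡⟨ ∑-distrib-+ (λ u → ⟦ h u ⟧ + heavy h u + repeats h u) (cherries h) ⟩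
      sum (λ u → ⟦ h u ⟧ + heavy h u + repeats h u) + sum (cherries h)
    ≡⟨ cong (_+ sum (cherries h)) (∑-distrib-+ (λ u → ⟦ h u ⟧ + heavy h u) (repeats h)) ⟩
      sum (λ u → ⟦ h u ⟧ + heavy h u) + sum (repeats h) + sum (cherries h)
    ≡⟨ cong (λ s → s + sum (repeats h) + sum (cherries h)) (∑-distrib-+ (⟦_⟧ ∘ h) (heavy h)) ⟩
      size h + sum (heavy h) + sum (repeats h) + sum (cherries h)
    ≤⟨ +-mono-≤ (+-mono-≤ (≤-reflexive (cong (size h +_) (sum-sumIn h (λ x u → 𝟙 (suc D ≤? codeg c x u))))) repeats-bound) cherries-bound ⟩
      size h + heavyTotal h + t * (t * (t * k)) + t * (t * D) ∎
    where
      open ≤-Reasoning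
      t = size h
      repeats-bound : sum (repeats h) ≤ t * (t * (t * k))
      repeats-bound =
        sumIn-swap-bounded h (λ x u → sumIn h λ y → sumIn h λ z → repeatAt x y z u) _ λ x _ →
        sumIn-swap-bounded h (λ y u → sumIn h λ z → repeatAt x y z u) _ λ y _ →
        sumIn-swap-bounded h (λ z u → repeatAt x y z u) _ λ z _ →
          ≤-trans (≤-reflexive (sym (*-distribˡ-sum (𝟙 (¬? (y Fin.≟ z))) λ u → 𝟙 (¬? (u Fin.≟ x) ×-dec (c x u ≟ c y z)))))
                  (𝟙*-≤ (¬? (y Fin.≟ z)) λ _ →
                     ≤-trans (≤-reflexive (sym (degColor≡ c x (c y z)))) (bounded x (c y z)))
      cherries-bound : sum (cherries h) ≤ t * (t * D)
      cherries-bound =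
        sumIn-swap-bounded h (λ x u → sumIn h λ y → cherryAt x y u) _ λ x hx →
        sumIn-swap-bounded h (λ y u → cherryAt x y u) _ λ y hy →
          ≤-trans (≤-reflexive (sym (*-distribˡ-sum (𝟙 (¬? (x Fin.≟ y))) (𝟙 ∘ cherry? c x y))))
                  (𝟙*-≤ (¬? (x Fin.≟ y)) λ x≢y →
                     ≤-trans (≤-reflexive (sym (codeg≡ c x y))) (low x y hx hy x≢y))

-- The part of the obstruction count not involving heavy vertices:
-- for t ≤ 3s it is at most 3s + 27ks³ + 45ks³, and 5s times that is ≤ 375ks⁴.
light-obstructions : ∀ {s k t} → 1 ≤ s → 1 ≤ k → t ≤ 3 * s →
  5 * s * (t + t * (t * (t * k)) + t * (t * (5 * k * s))) ≤ 375 * (k * (s * s * s * s))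
light-obstructions {s} {k} {t} 1≤s 1≤k t≤3s = begin
    5 * s * (t + t * (t * (t * k)) + t * (t * (5 * k * s)))
  ≤⟨ *-monoʳ-≤ (5 * s) (+-mono-≤ (+-mono-≤ t≤3s (*-mono-≤ t≤3s (*-mono-≤ t≤3s (*-monoˡ-≤ k t≤3s))))
                                    (*-mono-≤ t≤3s (*-monoˡ-≤ (5 * k * s) t≤3s))) ⟩
    5 * s * (3 * s + 3 * s * (3 * s * (3 * s * k)) + 3 * s * (3 * s * (5 * k * s)))
  ≡⟨ expand s k ⟩
    15 * (s * s) + 360 * (k * (s * s * s * s))
  ≤⟨ +-monoˡ-≤ (360 * (k * (s * s * s * s))) (*-monoʳ-≤ 15 s²≤ks⁴) ⟩
    15 * (k * (s * s * s * s)) + 360 * (k * (s * s * s * s))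
  ≡⟨ collect (k * (s * s * s * s)) ⟩
    375 * (k * (s * s * s * s)) ∎
  where
    open ≤-Reasoning
    expand : ∀ s k → 5 * s * (3 * s + 3 * s * (3 * s * (3 * s * k)) + 3 * s * (3 * s * (5 * k * s)))
                     ≡ 15 * (s * s) + 360 * (k * (s * s * s * s))
    expand = solve-∀
    collect : ∀ w → 15 * w + 360 * w ≡ 375 * w
    collect = solve-∀
    s²≤ks⁴ : s * s ≤ k * (s * s * s * s)
    s²≤ks⁴ = begin
        s * s               ≡⟨ sym (*-identityʳ (s * s)) ⟩
        s * s * 1           ≤⟨ *-monoʳ-≤ (s * s) (*-mono-≤ 1≤s 1≤s) ⟩
        s * s * (s * s)     ≡⟨ sym (*-assoc (s * s) s s) ⟩
        s * s * s * s       ≤⟨ m≤n*m (s * s * s * s) k ⦃ >-nonZero 1≤k ⦄ ⟩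
        k * (s * s * s * s) ∎

obstructions<n : ∀ {s k n t X} → 1 ≤ s → 1 ≤ k → 560 * k * (s * s * s) ≤ n → t ≤ 3 * s →
  5 * s * X ≤ t * n → t + X + t * (t * (t * k)) + t * (t * (5 * k * s)) < n
obstructions<n {s} {k} {n} {t} {X} 1≤s 1≤k n-large t≤3s heavy =
  *-cancelˡ-< (5 * s) (t + X + t * (t * (t * k)) + t * (t * (5 * k * s))) n (begin-strict
    5 * s * (t + X + t * (t * (t * k)) + t * (t * (5 * k * s)))
  ≡⟨ regroup s k t X ⟩
    5 * s * (t + t * (t * (t * k)) + t * (t * (5 * k * s))) + 5 * s * X
  ≤⟨ +-mono-≤ (light-obstructions 1≤s 1≤k t≤3s) (≤-trans heavy (*-monoˡ-≤ n t≤3s)) ⟩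
    375 * w + 3 * s * n
  <⟨ +-monoˡ-< (3 * s * n) 375w<2sn ⟩
    2 * s * n + 3 * s * n
  ≡⟨ split s n ⟩
    5 * s * n ∎)
  where
    open ≤-Reasoning
    w = k * (s * s * s * s)
    regroup : ∀ s k t X → 5 * s * (t + X + t * (t * (t * k)) + t * (t * (5 * k * s)))
                          ≡ 5 * s * (t + t * (t * (t * k)) + t * (t * (5 * k * s))) + 5 * s * X
    regroup = solve-∀
    split : ∀ s n → 2 * s * n + 3 * s * n ≡ 5 * s * n
    split = solve-∀
    scale : ∀ s k → 2 * s * (560 * k * (s * s * s)) ≡ 375 * (k * (s * s * s * s)) + 745 * (k * (s * s * s * s))
    scale = solve-∀
    1≤w : 1 ≤ w
    1≤w = *-mono-≤ 1≤k (*-mono-≤ (*-mono-≤ (*-mono-≤ 1≤s 1≤s) 1≤s) 1≤s)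
    375w<2sn : 375 * w < 2 * s * n
    375w<2sn = begin-strict
      375 * w                            <⟨ m<m+n (375 * w) (≤-trans 1≤w (m≤n*m w 745)) ⟩
      375 * w + 745 * w                  ≡⟨ sym (scale s k) ⟩
      2 * s * (560 * k * (s * s * s))    ≤⟨ *-monoʳ-≤ (2 * s) n-large ⟩
      2 * s * n                          ∎

module Greedy {n : ℕ} (c : Coloring n) (c-sym : Symmetric c) {k : ℕ} (1≤k : 1 ≤ k)
              (bounded : LocallyBounded k c) {s : ℕ} (1≤s : 1 ≤ s)
              (n-large : 560 * k * (s * s * s) ≤ n) where
  open GreedyStep c c-sym k bounded (5 * k * s)

  -- Each x has at most n/(5s) partners u with codeg(x,u) > 5ks (few-heavy, cancelling k).
  heavyTotal-bound : ∀ h → 5 * s * heavyTotal h ≤ size h * n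
  heavyTotal-bound h = begin
      5 * s * sumIn h M
    ≡⟨ *-distribˡ-sum (5 * s) (λ x → ⟦ h x ⟧ * M x) ⟩
      sum (λ x → 5 * s * (⟦ h x ⟧ * M x))
    ≡⟨ sum-cong-≗ {n} (λ x → rotate (5 * s) ⟦ h x ⟧ (M x)) ⟩
      sumIn h (λ x → M x * (5 * s))
    ≤⟨ sumIn-bounded h n (λ x _ → per-vertex x) ⟩
      size h * n ∎
    where
      open ≤-Reasoning
      M : Fin n → ℕ
      M x = sum (λ u → 𝟙 (suc (5 * k * s) ≤? codeg c x u))
      rotate : ∀ a b m → a * (b * m) ≡ b * (m * a)
      rotate = solve-∀
      reorder : ∀ m s k → k * (m * (5 * s)) ≡ m * (5 * k * s)
      reorder = solve-∀
      per-vertex : ∀ x → M x * (5 * s) ≤ n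
      per-vertex x = *-cancelˡ-≤ k ⦃ >-nonZero 1≤k ⦄ (begin
          k * (M x * (5 * s))        ≡⟨ reorder (M x) s k ⟩
          M x * (5 * k * s)          ≤⟨ *-monoʳ-≤ (M x) (n≤1+n _) ⟩
          M x * suc (5 * k * s)      ≤⟨ few-heavy c k bounded x (5 * k * s) ⟩
          n * k                      ≡⟨ *-comm n k ⟩
          k * n                      ∎)

  RainbowOfSize : ℕ → Set
  RainbowOfSize t = Σ (Fin n → Bool) λ h → size h ≡ t × IsRainbow h × LowCodeg h

  -- While t ≤ 3s fewer than n vertices are obstructed, so some vertex can be added.
  grow : ∀ {t} → t ≤ 3 * s → RainbowOfSize t → RainbowOfSize (suc t)
  grow t≤3s (h , refl , rainbow , low) = extend (zero-term (obstructions h) obstructed<n)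
    where
      obstructed<n : sum (obstructions h) < n
      obstructed<n = ≤-<-trans (total-obstructions h low)
                               (obstructions<n 1≤s 1≤k n-large t≤3s (heavyTotal-bound h))
      extend : (∃ λ u → obstructions h u ≡ 0) → RainbowOfSize (suc (size h))
      extend (u , unobstructed) = insert h u , insert-size , insert-rainbow rainbow , insert-lowCodeg low
        where open Insertion (unobstructed⇒addable h u unobstructed)

  greedy : ∀ t → t ≤ 2 * s + 2 → RainbowOfSize t
  greedy zero    _         = (λ _ → false) , trans (sum-const n 0) (*-zeroʳ n) , (λ _ _ _ _ ()) , (λ _ _ ())
  greedy (suc t) 1+t≤2s+2 = grow t≤3s (greedy t (<⇒≤ 1+t≤2s+2))
    where
      t≤3s : t ≤ 3 * s
      t≤3s = begin
        t              ≤⟨ ≤-pred (≤-trans 1+t≤2s+2 (≤-reflexive (+-suc (2 * s) 1))) ⟩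
        2 * s + 1      ≤⟨ +-monoʳ-≤ (2 * s) 1≤s ⟩
        2 * s + s      ≡⟨ triple s ⟩
        3 * s          ∎
        where
          open ≤-Reasoning
          triple : ∀ s → 2 * s + s ≡ 3 * s
          triple = solve-∀

rainbow⇒proper : ∀ {n} (c : Coloring n) H → Rainbow c H → ProperlyColored c H
rainbow⇒proper c H rainbow x y z x∈ y∈ z∈ x≢y x≢z y≢z =
  rainbow x y x z x∈ y∈ x∈ z∈ x≢y x≢z λ { (inj₁ (_ , y≡z)) → y≢z y≡z ; (inj₂ (x≡z , _)) → x≢z x≡z }

fourth-root : ∀ r → ∃ λ s → s ^ 4 ≤ r × r < suc s ^ 4
fourth-root zero = 0 , z≤n , s≤s z≤n
fourth-root (suc r) with fourth-root r
... | s , s⁴≤r , r<[1+s]⁴ with suc s ^ 4 ≤? suc r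
...   | yes [1+s]⁴≤1+r = suc s , [1+s]⁴≤1+r ,
          ≤-<-trans (≤-reflexive (≤-antisym r<[1+s]⁴ [1+s]⁴≤1+r)) (^-monoˡ-< 4 (n<1+n (suc s)))
...   | no  [1+s]⁴≰1+r = s , m≤n⇒m≤1+n s⁴≤r , ≰⇒> [1+s]⁴≰1+r

^4-cancel-≤ : ∀ {a b} → a ^ 4 ≤ b ^ 4 → a ≤ b
^4-cancel-≤ a⁴≤b⁴ = ≮⇒≥ λ b<a → <⇒≱ (^-monoˡ-< 4 b<a) a⁴≤b⁴

^4-distrib-* : ∀ a b → (a * b) ^ 4 ≡ a ^ 4 * b ^ 4
^4-distrib-* = unfolded
  where
    unfolded : ∀ a b → a * b * (a * b * (a * b * (a * b * 1))) ≡ a * (a * (a * (a * 1))) * (b * (b * (b * (b * 1))))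
    unfolded = solve-∀

cube^4 : ∀ s → (s * s * s) ^ 4 ≡ (s ^ 4) ^ 3
cube^4 = unfolded
  where
    unfolded : ∀ s → let c = s * s * s ; q = s * (s * (s * (s * 1))) in c * (c * (c * (c * 1))) ≡ q * (q * (q * 1))
    unfolded = solve-∀

n-large : ∀ {n k r s} → (560 * k) ^ 4 * r ^ 3 ≤ n ^ 4 → s ^ 4 ≤ r → 560 * k * (s * s * s) ≤ n
n-large {n} {k} {r} {s} hyp s⁴≤r = ^4-cancel-≤ (begin
    (560 * k * (s * s * s)) ^ 4      ≡⟨ ^4-distrib-* (560 * k) (s * s * s) ⟩
    (560 * k) ^ 4 * (s * s * s) ^ 4  ≡⟨ cong ((560 * k) ^ 4 *_) (cube^4 s) ⟩
    (560 * k) ^ 4 * (s ^ 4) ^ 3      ≤⟨ *-monoʳ-≤ ((560 * k) ^ 4) (^-monoˡ-≤ 3 s⁴≤r) ⟩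
    (560 * k) ^ 4 * r ^ 3            ≤⟨ hyp ⟩
    n ^ 4                            ∎)
  where open ≤-Reasoning

toSubset-size : ∀ {n} (h : Fin n → Bool) → ∣ Vec.tabulate h ∣ ≡ size h
toSubset-size {zero}  h = refl
toSubset-size {suc n} h with h zero
... | true  = cong suc (toSubset-size (h ∘ suc))
... | false = toSubset-size (h ∘ suc)

toSubset-member : ∀ {n} (h : Fin n → Bool) x → x ∈ Vec.tabulate h → h x ≡ true
toSubset-member h x x∈ = trans (sym (lookup∘tabulate h x)) ([]=⇒lookup x∈)

rainbow-clique : (n k r : ℕ) → 0 < k → 0 < r → (560 * k) ^ 4 * r ^ 3 ≤ n ^ 4 →
  (c : Coloring n) → Symmetric c → LocallyBounded k c →
  ∃ λ (H : Subset n) → LargeEnough r H × Rainbow c H × SmallCodeg k r c H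
rainbow-clique n k r 1≤k 1≤r hyp c c-sym bounded with fourth-root r
... | zero , _ , r<1 = contradiction 1≤r (<⇒≱ r<1)
... | suc s′ , s⁴≤r , r<[1+s]⁴ = clique (greedy (2 * s + 2) ≤-refl)
  where
    s = suc s′
    open Greedy c c-sym 1≤k bounded {s} (s≤s z≤n) (n-large {n} {k} {r} {s} hyp s⁴≤r)

    clique : RainbowOfSize (2 * s + 2) →
      ∃ λ (H : Subset n) → LargeEnough r H × Rainbow c H × SmallCodeg k r c H
    clique (h , |h|≡2s+2 , rainbow , low) = H , large , rainbow-H , small
      where
        H : Subset n
        H = Vec.tabulate h
        member : ∀ x → x ∈ H → h x ≡ true
        member = toSubset-member h

        double : ∀ s → 2 * s + 2 ≡ 2 * suc s
        double = solve-∀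

        large : LargeEnough r H
        large = begin
          16 * r             ≤⟨ *-monoʳ-≤ 16 (<⇒≤ r<[1+s]⁴) ⟩
          2 ^ 4 * suc s ^ 4  ≡⟨ sym (^4-distrib-* 2 (suc s)) ⟩
          (2 * suc s) ^ 4    ≡⟨ cong (_^ 4) (sym (trans (toSubset-size h) (trans |h|≡2s+2 (double s)))) ⟩
          ∣ H ∣ ^ 4          ∎
          where open ≤-Reasoning

        rainbow-H : Rainbow c H
        rainbow-H x y z w x∈ y∈ z∈ w∈ = rainbow x y z w (member x x∈) (member y y∈) (member z z∈) (member w w∈)

        small : SmallCodeg k r c H
        small x y x∈ y∈ x≢y = begin
          codeg c x y ^ 4      ≤⟨ ^-monoˡ-≤ 4 (low x y (member x x∈) (member y y∈) x≢y) ⟩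
          (5 * k * s) ^ 4      ≡⟨ ^4-distrib-* (5 * k) s ⟩
          (5 * k) ^ 4 * s ^ 4  ≡⟨ cong (_* s ^ 4) (^4-distrib-* 5 k) ⟩
          625 * k ^ 4 * s ^ 4  ≤⟨ *-monoʳ-≤ (625 * k ^ 4) s⁴≤r ⟩
          625 * k ^ 4 * r      ∎
          where open ≤-Reasoning

lemma3p1 : (n k r : ℕ) → 0 < n → 0 < k → 0 < r →
    (560 * k) ^ 4 * r ^ 3 ≤ n ^ 4 →
    ((c : Coloring n) → Symmetric c → LocallyBounded k c →
      ∃ λ (H : Subset n) → LargeEnough r H × ProperlyColored c H × SmallCodeg k r c H)
    × ((c : Coloring n) → Symmetric c → GloballyBounded k c →
      ∃ λ (H : Subset n) → LargeEnough r H × Rainbow c H × SmallCodeg k r c H)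
lemma3p1 n k r _ 0<k 0<r hyp = locally , globally
  where
    locally : (c : Coloring n) → Symmetric c → LocallyBounded k c →
      ∃ λ (H : Subset n) → LargeEnough r H × ProperlyColored c H × SmallCodeg k r c H
    locally c c-sym bounded with rainbow-clique n k r 0<k 0<r hyp c c-sym bounded
    ... | H , large , rainbow , small = H , large , rainbow⇒proper c H rainbow , small

    globally : (c : Coloring n) → Symmetric c → GloballyBounded k c →
      ∃ λ (H : Subset n) → LargeEnough r H × Rainbow c H × SmallCodeg k r c H
    globally c c-sym bounded = rainbow-clique n k r 0<k 0<r hyp c c-sym (globally⇒locally c k c-sym bounded)
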